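{- Let $\sigma$ be a maximal simplex of $\mathcal{N}(\mathbb{I}_n,3)$. If $|N(v)\cap\sigma|\ge 3$ for some vertex $v\in V(\mathbb{I}_n)$, then $N(v)\subseteq\sigma$.
   Context: For a finite simple connected graph $G$ and a real number $r\ge 0$, the Čech complex $\mathcal{N}(G,r)$ is the simplicial complex with vertex set $V(G)$ in which a finite nonempty set $\sigma\subseteq V(G)$ is a simplex if and only if the closed balls of radius $\frac r2$ centered at the vertices of $\sigma$ have a common point, the balls being taken in the geometric realization of $G$ with the shortest path metric in which each edge is isometric to $[0,1]$. The hypercube graph $\mathbb{I}_n$ has vertex set $\{0,1\}^n$, two vertices adjacent iff they differ in exactly one coordinate. $N(v)$ denotes the open neighborhood of $v$, i.e. the set of vertices adjacent to $v$ (not containing $v$).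
   Formalization: Points of the geometric realization of $\mathbb{I}_n$ are taken at rational positions along the edges, so each edge point corresponds to a rational point of $[0,1]$. -}

module Defs where

open import Data.Nat using (ℕ; zero; suc)
open import Data.Integer using (+_)
open import Data.Rational using (ℚ; _+_; _-_; _≤_; _/_; 0ℚ; 1ℚ; _*_; ½)
open import Data.Bool using (Bool)
open import Data.Fin using (Fin)
open import Data.Vec using (Vec; lookup)
open import Data.Product using (Σ; ∃; _×_)
open import Data.Sum using (_⊎_)
open import Relation.Binary.PropositionalEquality using (_≡_; _≢_)

Vertex : ℕ → Set
Vertex n = Vec Bool n

Adj : ∀ {n} → Vertex n → Vertex n → Set
Adj {n} u w = Σ (Fin n) λ i → (lookup u i ≢ lookup w i) × (∀ j → j ≢ i → lookup u j ≡ lookup w j)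

data Walk {n : ℕ} : Vertex n → Vertex n → ℕ → Set where
  here : ∀ {u} → Walk u u zero
  step : ∀ {u v w k} → Adj u v → Walk v w k → Walk u w (suc k)

ℕtoℚ : ℕ → ℚ
ℕtoℚ k = + k / 1

-- Points of the geometric realization of I_n:
-- a vertex, or a point on the edge {a,b} at parameter t ∈ [0,1] (distance t from a).
data Point (n : ℕ) : Set where
  vtx  : Vertex n → Point n
  onEdge : (a b : Vertex n) → Adj a b → (t : ℚ) → 0ℚ ≤ t → t ≤ 1ℚ → Point n

-- DistLE u p ρ : the shortest-path distance in |I_n| from vertex u to point p is ≤ ρ.
-- (A geodesic from a vertex to a point inside edge {a,b} passes through a or b;
--  graph distance is the minimum length of a walk.)
DistLE : ∀ {n} → Vertex n → Point n → ℚ → Set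
DistLE u (vtx x) ρ = ∃ λ k → Walk u x k × (ℕtoℚ k ≤ ρ)
DistLE u (onEdge a b _ t _ _) ρ =
  (∃ λ k → Walk u a k × (ℕtoℚ k + t ≤ ρ)) ⊎
  (∃ λ k → Walk u b k × (ℕtoℚ k + (1ℚ - t) ≤ ρ))

-- Sets of vertices, as predicates (the vertex set is finite, so all are finite)
VSet : ℕ → Set₁
VSet n = Vertex n → Set

_⊆_ : ∀ {n} → VSet n → VSet n → Set
σ ⊆ τ = ∀ u → σ u → τ u

-- σ is a simplex of the Čech complex N(I_n, r): nonempty and the closed balls
-- of radius r/2 around its vertices share a common point.
IsCechSimplex : (n : ℕ) → ℚ → VSet n → Set
IsCechSimplex n r σ = (∃ λ u → σ u) × (∃ λ (p : Point n) → ∀ u → σ u → DistLE u p (r * ½))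

IsMaximalCechSimplex : (n : ℕ) → ℚ → VSet n → Set₁
IsMaximalCechSimplex n r σ =
  IsCechSimplex n r σ × (∀ τ → IsCechSimplex n r τ → σ ⊆ τ → τ ⊆ σ)

-- Let p be a common point of the balls of radius 3/2 around three distinct neighbours u₁ u₂ u₃
-- of v. Take w = p if p is a vertex, and otherwise the end of the edge carrying p that has the
-- parity of v. Since I_n is bipartite, each uᵢ is adjacent to w or is the other end of that edge
-- (itself adjacent to w), and p lies within 1/2 of w. Two distinct vertices of I_n have at most
-- two common neighbours, so w = v. Hence p is within 3/2 of every neighbour of v, and the
-- maximality of σ puts all of them into σ.
module Submission where

open import Defs
open import Data.Nat as ℕ using (ℕ; suc)
open import Data.Integer as ℤ using (+_)
open import Data.Rational using (ℚ; _+_; _-_; _≤_; _/_; 0ℚ; 1ℚ; _*_; ½; mkℚ; *≤*; -_)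
open import Data.Rational.Properties
  using (↥p/↧p≡p; ≤-trans; +-mono-≤; +-monoʳ-≤; +-monoˡ-≤; +-identityʳ; ≤-refl; ≤⇒≤ᵇ; ≤ᵇ⇒≤)
open import Data.Rational.Solver using (module +-*-Solver)
open +-*-Solver using (solve; _:+_; _:-_; :-_; _:=_; con)
open import Data.Nat.Coprimality using (1-coprimeTo) renaming (sym to coprime-sym)
open import Data.Bool using (Bool; false; not; _xor_)
open import Data.Bool.Properties as Bool using (not-¬; ¬-not; not-distribˡ-xor; not-distribʳ-xor)
open import Data.Fin using (Fin; zero; suc)
open import Data.Fin.Properties using (suc-injective) renaming (_≟_ to _≟ᶠ_)
open import Data.Vec using (Vec; []; _∷_; lookup; tabulate)
open import Data.Vec.Properties using (tabulate∘lookup; tabulate-cong)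
open import Data.Product using (Σ; _×_; _,_; proj₁)
open import Data.Sum using (_⊎_; inj₁; inj₂; [_,_]; swap; map₂)
open import Data.Empty using (⊥-elim)
open import Data.Unit using (tt)
open import Relation.Nullary using (¬_; yes; no)
open import Relation.Binary.PropositionalEquality
  using (_≡_; _≢_; refl; sym; trans; cong; subst; ≢-sym; module ≡-Reasoning)
open import Function using (_∘_)

radius : ℚ
radius = + 3 / 1 * ½

ℕtoℚ-normal : ∀ m → ℕtoℚ m ≡ mkℚ (+ m) 0 (coprime-sym (1-coprimeTo m))
ℕtoℚ-normal m = ↥p/↧p≡p (mkℚ (+ m) 0 (coprime-sym (1-coprimeTo m)))

-- `+ m / 1` normalises through a gcd and is stuck for a variable m.
2≤2+k : ∀ k → + 2 / 1 ≤ ℕtoℚ (suc (suc k))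
2≤2+k k rewrite ℕtoℚ-normal (suc (suc k)) = *≤* (ℤ.+≤+ (ℕ.s≤s (ℕ.s≤s ℕ.z≤n)))

-- The closed comparison 2 ≤ᵇ 3/2 computes to false.
2+k+s≰radius : ∀ k {s} → 0ℚ ≤ s → ¬ (ℕtoℚ (suc (suc k)) + s ≤ radius)
2+k+s≰radius k 0≤s le = ≤⇒≤ᵇ (≤-trans (+-mono-≤ (2≤2+k k) 0≤s) le)

1+s≤radius⇒s≤½ : ∀ s → ℕtoℚ 1 + s ≤ radius → s ≤ ½
1+s≤radius⇒s≤½ s le = subst (_≤ ½) (-1+[1+s]≡s s) (+-monoʳ-≤ (- 1ℚ) le)
  where
  -1+[1+s]≡s : ∀ s → - 1ℚ + (1ℚ + s) ≡ s
  -1+[1+s]≡s = solve 1 (λ s → (:- con 1ℚ) :+ (con 1ℚ :+ s) := s) refl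

s≤½⇒1+s≤radius : ∀ {s} → s ≤ ½ → ℕtoℚ 1 + s ≤ radius
s≤½⇒1+s≤radius = +-monoʳ-≤ 1ℚ

t≤1⇒0≤1-t : ∀ t → t ≤ 1ℚ → 0ℚ ≤ 1ℚ - t
t≤1⇒0≤1-t t le = subst (_≤ 1ℚ - t) (t-t≡0 t) (+-monoˡ-≤ (- t) le)
  where
  t-t≡0 : ∀ t → t - t ≡ 0ℚ
  t-t≡0 = solve 1 (λ t → t :- t := con 0ℚ) refl

vertex-ext : ∀ {n} {x y : Vertex n} → (∀ i → lookup x i ≡ lookup y i) → x ≡ y
vertex-ext {x = x} {y} eq = begin
  x                   ≡⟨ tabulate∘lookup x ⟨
  tabulate (lookup x) ≡⟨ tabulate-cong eq ⟩
  tabulate (lookup y) ≡⟨ tabulate∘lookup y ⟩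
  y                   ∎
  where open ≡-Reasoning

parity : ∀ {n} → Vertex n → Bool
parity []       = false
parity (b ∷ bs) = b xor parity bs

parity-adj : ∀ {n} {x y : Vertex n} → Adj x y → parity y ≡ not (parity x)
parity-adj {x = a ∷ xs} {b ∷ ys} (zero , a≢b , agree)
  rewrite vertex-ext {x = xs} {ys} (λ j → agree (suc j) λ ())
        | ¬-not (≢-sym a≢b) = sym (not-distribˡ-xor a (parity ys))
parity-adj {x = a ∷ xs} {b ∷ ys} (suc i , differ , agree)
  rewrite sym (agree zero λ ())
        | parity-adj {x = xs} {ys} (i , differ , λ j j≢i → agree (suc j) (j≢i ∘ suc-injective))
  = sym (not-distribʳ-xor a (parity xs))

module _ {n : ℕ} where

  adj-sym : {x y : Vertex n} → Adj x y → Adj y x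
  adj-sym (i , differ , agree) = i , ≢-sym differ , λ j j≢i → sym (agree j j≢i)

  adj-index-injective : {v x y : Vertex n} (p : Adj v x) (q : Adj v y) → proj₁ p ≡ proj₁ q → x ≡ y
  adj-index-injective {v} {x} {y} (i , differˣ , agreeˣ) (.i , differʸ , agreeʸ) refl = vertex-ext same
    where
    same : ∀ j → lookup x j ≡ lookup y j
    same j with j ≟ᶠ i
    ... | yes refl = trans (¬-not (≢-sym differˣ)) (sym (¬-not (≢-sym differʸ)))
    ... | no j≢i = trans (sym (agreeˣ j j≢i)) (agreeʸ j j≢i)

  AgreeOutside : Vertex n → Vertex n → Fin n → Fin n → Set
  AgreeOutside x y i m = ∀ j → j ≢ i → j ≢ m → lookup x j ≡ lookup y j

  adj-adj-returns-or-differs : {v u a : Vertex n} (p : Adj v u) (q : Adj u a) →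
    a ≡ v ⊎ (lookup a (proj₁ p) ≢ lookup v (proj₁ p) × AgreeOutside a v (proj₁ p) (proj₁ q))
  adj-adj-returns-or-differs {v} {u} {a} (i , vᵢ≢uᵢ , agreeᵛᵘ) (m , uₘ≢aₘ , agreeᵘᵃ) with m ≟ᶠ i
  ... | yes refl = inj₁ (vertex-ext returns)
    where
    returns : ∀ j → lookup a j ≡ lookup v j
    returns j with j ≟ᶠ m
    ... | yes refl = trans (¬-not (≢-sym uₘ≢aₘ)) (sym (¬-not vᵢ≢uᵢ))
    ... | no j≢m = trans (sym (agreeᵘᵃ j j≢m)) (sym (agreeᵛᵘ j j≢m))
  ... | no m≢i = inj₂ (aᵢ≢vᵢ , λ j j≢i j≢m → trans (sym (agreeᵘᵃ j j≢m)) (sym (agreeᵛᵘ j j≢i)))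
    where
    aᵢ≢vᵢ : lookup a i ≢ lookup v i
    aᵢ≢vᵢ aᵢ≡vᵢ = vᵢ≢uᵢ (trans (sym aᵢ≡vᵢ) (sym (agreeᵘᵃ i (≢-sym m≢i))))

  agreeOutside-differs⇒≡ : {x y : Vertex n} {i m k : Fin n} → AgreeOutside x y i m →
    lookup x k ≢ lookup y k → k ≢ i → k ≡ m
  agreeOutside-differs⇒≡ {m = m} {k} agree differ k≢i with k ≟ᶠ m
  ... | yes k≡m = k≡m
  ... | no k≢m = ⊥-elim (differ (agree k k≢i k≢m))

  same-parity⇒¬adj : {x y : Vertex n} → parity x ≡ parity y → ¬ Adj x y
  same-parity⇒¬adj {x} {y} x≡y x~y = not-¬ (sym x≡y) (parity-adj {x = x} {y} x~y)

  one-end-has-parity : {a b : Vertex n} → Adj a b → (β : Bool) → parity a ≡ β ⊎ parity b ≡ β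
  one-end-has-parity {a} {b} a~b β with parity a Bool.≟ β
  ... | yes a≡β = inj₁ a≡β
  ... | no a≢β = inj₂ (trans (parity-adj {x = a} {b} a~b) (sym (¬-not (≢-sym a≢β))))

  no-triangle : {v a b : Vertex n} → Adj v a → Adj v b → ¬ Adj a b
  no-triangle {v} {a} {b} v~a v~b =
    same-parity⇒¬adj {a} {b} (trans (parity-adj {x = v} {a} v~a) (sym (parity-adj {x = v} {b} v~b)))

  record Claw (v : Vertex n) : Set where
    field
      {leaf₁ leaf₂ leaf₃} : Vertex n
      adj₁ : Adj v leaf₁
      adj₂ : Adj v leaf₂
      adj₃ : Adj v leaf₃
      leaf₁≢leaf₂ : leaf₁ ≢ leaf₂
      leaf₁≢leaf₃ : leaf₁ ≢ leaf₃
      leaf₂≢leaf₃ : leaf₂ ≢ leaf₃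

  open Claw

  AllLeaves : {v : Vertex n} → Claw v → (Vertex n → Set) → Set
  AllLeaves c P = P (leaf₁ c) × P (leaf₂ c) × P (leaf₃ c)

  claw-common-neighbour⇒centre : {v x : Vertex n} (c : Claw v) → AllLeaves c (λ u → Adj u x) → x ≡ v
  claw-common-neighbour⇒centre {v} {x} c (u₁~x , u₂~x , u₃~x)
    with adj-adj-returns-or-differs {v = v} {leaf₁ c} {x} (adj₁ c) u₁~x
       | adj-adj-returns-or-differs {v = v} {leaf₂ c} {x} (adj₂ c) u₂~x
       | adj-adj-returns-or-differs {v = v} {leaf₃ c} {x} (adj₃ c) u₃~x
  ... | inj₁ x≡v | _ | _ = x≡v
  ... | inj₂ _ | inj₁ x≡v | _ = x≡v
  ... | inj₂ _ | inj₂ _ | inj₁ x≡v = x≡v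
  ... | inj₂ (_ , agree₁) | inj₂ (differ₂ , _) | inj₂ (differ₃ , _) =
    ⊥-elim (leaf₂≢leaf₃ c (index-injective (adj₂ c) (adj₃ c) (trans i₂≡m₁ (sym i₃≡m₁))))
    where
    index-injective : {y z : Vertex n} (p : Adj v y) (q : Adj v z) → proj₁ p ≡ proj₁ q → y ≡ z
    index-injective {y} {z} = adj-index-injective {v = v} {y} {z}

    m₁ : Fin n
    m₁ = proj₁ u₁~x

    i₂≡m₁ : proj₁ (adj₂ c) ≡ m₁
    i₂≡m₁ = agreeOutside-differs⇒≡ {x = x} {v} agree₁ differ₂ λ i₂≡i₁ →
      leaf₁≢leaf₂ c (index-injective (adj₁ c) (adj₂ c) (sym i₂≡i₁))

    i₃≡m₁ : proj₁ (adj₃ c) ≡ m₁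
    i₃≡m₁ = agreeOutside-differs⇒≡ {x = x} {v} agree₁ differ₃ λ i₃≡i₁ →
      leaf₁≢leaf₃ c (index-injective (adj₁ c) (adj₃ c) (sym i₃≡i₁))

  mapLeaves : {v : Vertex n} {P Q : Vertex n → Set} (c : Claw v) →
    (∀ {u} → P u → Q u) → AllLeaves c P → AllLeaves c Q
  mapLeaves c f (p₁ , p₂ , p₃) = f p₁ , f p₂ , f p₃

  Near : Vertex n → Vertex n → Set
  Near u x = u ≡ x ⊎ Adj u x

  near-neighbours⇒adj : {v u u′ x : Vertex n} → Adj v u → Adj v u′ → u ≢ u′ →
    Near u x → Near u′ x → Adj u x
  near-neighbours⇒adj _ _ _ (inj₂ u~x) _ = u~x
  near-neighbours⇒adj _ _ u≢u′ (inj₁ refl) (inj₁ u′≡u) = ⊥-elim (u≢u′ (sym u′≡u))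
  near-neighbours⇒adj {v} {u} {u′} v~u v~u′ _ (inj₁ refl) (inj₂ u′~u) =
    ⊥-elim (no-triangle {v} {u′} {u} v~u′ v~u u′~u)

  claw-near⇒centre : {v x : Vertex n} (c : Claw v) → AllLeaves c (λ u → Near u x) → x ≡ v
  claw-near⇒centre {v} {x} c (near₁ , near₂ , near₃) = claw-common-neighbour⇒centre c
    ( near-neighbours⇒adj {v} {leaf₁ c} {leaf₂ c} (adj₁ c) (adj₂ c) (leaf₁≢leaf₂ c) near₁ near₂
    , near-neighbours⇒adj {v} {leaf₂ c} {leaf₁ c} (adj₂ c) (adj₁ c) (≢-sym (leaf₁≢leaf₂ c)) near₂ near₁
    , near-neighbours⇒adj {v} {leaf₃ c} {leaf₁ c} (adj₃ c) (adj₁ c) (≢-sym (leaf₁≢leaf₃ c)) near₃ near₁ )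

  NearEnd : Vertex n → Vertex n → ℚ → Set
  NearEnd u e s = u ≡ e ⊎ (Adj u e × s ≤ ½)

  near-edge-at-same-parity-end : {v u e f : Vertex n} {s s′ : ℚ} →
    parity e ≡ parity v → Adj e f → Adj v u →
    NearEnd u e s ⊎ NearEnd u f s′ → (Adj u e × s ≤ ½) ⊎ u ≡ f
  near-edge-at-same-parity-end {v} {u} e≡v _ v~u (inj₁ (inj₁ refl)) =
    ⊥-elim (same-parity⇒¬adj {v} {u} (sym e≡v) v~u)
  near-edge-at-same-parity-end _ _ _ (inj₁ (inj₂ near)) = inj₁ near
  near-edge-at-same-parity-end _ _ _ (inj₂ (inj₁ u≡f)) = inj₂ u≡f
  near-edge-at-same-parity-end {v} {u} {e} {f} e≡v e~f v~u (inj₂ (inj₂ (u~f , _))) =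
    ⊥-elim (same-parity⇒¬adj {u} {f} u≡f u~f)
    where
    open ≡-Reasoning
    u≡f : parity u ≡ parity f
    u≡f = begin
      parity u       ≡⟨ parity-adj {x = v} {u} v~u ⟩
      not (parity v) ≡⟨ cong not e≡v ⟨
      not (parity e) ≡⟨ parity-adj {x = e} {f} e~f ⟨
      parity f       ∎

  claw-near-edge⇒centre : {v e f : Vertex n} {s s′ : ℚ} (c : Claw v) →
    parity e ≡ parity v → Adj e f →
    AllLeaves c (λ u → NearEnd u e s ⊎ NearEnd u f s′) → e ≡ v × s ≤ ½
  claw-near-edge⇒centre {v} {e} {f} {s} c e≡v e~f (near₁ , near₂ , near₃) =
    claw-common-neighbour⇒centre c (mapLeaves c (λ {u} → adj-e {u}) reduced) , end-close reduced
    where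
    Reduced : Vertex n → Set
    Reduced u = (Adj u e × s ≤ ½) ⊎ u ≡ f

    reduced : AllLeaves c Reduced
    reduced = near-edge-at-same-parity-end {v} {leaf₁ c} e≡v e~f (adj₁ c) near₁
            , near-edge-at-same-parity-end {v} {leaf₂ c} e≡v e~f (adj₂ c) near₂
            , near-edge-at-same-parity-end {v} {leaf₃ c} e≡v e~f (adj₃ c) near₃

    adj-e : ∀ {u} → Reduced u → Adj u e
    adj-e (inj₁ (u~e , _)) = u~e
    adj-e (inj₂ refl) = adj-sym {x = e} {f} e~f

    end-close : AllLeaves c Reduced → s ≤ ½
    end-close (inj₁ (_ , s≤½) , _) = s≤½
    end-close (inj₂ _ , inj₁ (_ , s≤½) , _) = s≤½
    end-close (inj₂ u₁≡f , inj₂ u₂≡f , _) = ⊥-elim (leaf₁≢leaf₂ c (trans u₁≡f (sym u₂≡f)))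

  walk-within-radius : {u x : Vertex n} {k : ℕ} {s : ℚ} →
    Walk u x k → ℕtoℚ k + s ≤ radius → 0ℚ ≤ s → NearEnd u x s
  walk-within-radius here _ _ = inj₁ refl
  walk-within-radius (step u~x here) le _ = inj₂ (u~x , 1+s≤radius⇒s≤½ _ le)
  walk-within-radius {k = suc (suc k)} (step _ (step _ _)) le 0≤s = ⊥-elim (2+k+s≰radius k 0≤s le)

  near-vertex : {u x : Vertex n} → DistLE u (vtx x) radius → Near u x
  near-vertex (_ , walk , le) =
    map₂ proj₁ (walk-within-radius walk (subst (_≤ radius) (sym (+-identityʳ _)) le) (≤-refl {0ℚ}))

  near-edge : {u a b : Vertex n} {a~b : Adj a b} {t : ℚ} {0≤t : 0ℚ ≤ t} {t≤1 : t ≤ 1ℚ} →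
    DistLE u (onEdge a b a~b t 0≤t t≤1) radius → NearEnd u a t ⊎ NearEnd u b (1ℚ - t)
  near-edge {0≤t = 0≤t} (inj₁ (_ , walk , le)) = inj₁ (walk-within-radius walk le 0≤t)
  near-edge {t = t} {t≤1 = t≤1} (inj₂ (_ , walk , le)) = inj₂ (walk-within-radius walk le (t≤1⇒0≤1-t t t≤1))

  claw-ball⇒neighbour-ball : {v u : Vertex n} (c : Claw v) (p : Point n) →
    AllLeaves c (λ w → DistLE w p radius) → Adj v u → DistLE u p radius
  claw-ball⇒neighbour-ball {v} {u} c (vtx x) balls v~u =
    subst (λ y → DistLE u (vtx y) radius) (sym x≡v) (1 , step (adj-sym {x = v} {u} v~u) here , ≤ᵇ⇒≤ tt)
    where
    x≡v : x ≡ v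
    x≡v = claw-near⇒centre c (mapLeaves c (λ {w} → near-vertex {w}) balls)
  claw-ball⇒neighbour-ball {v} {u} c (onEdge a b a~b t 0≤t t≤1) balls v~u =
    [ via-a , via-b ] (one-end-has-parity {a} {b} a~b (parity v))
    where
    p : Point n
    p = onEdge a b a~b t 0≤t t≤1

    near-ends : ∀ {w} → DistLE w p radius → NearEnd w a t ⊎ NearEnd w b (1ℚ - t)
    near-ends {w} = near-edge {w} {a} {b} {a~b} {t} {0≤t} {t≤1}

    walk-from-u : {e : Vertex n} → e ≡ v → Walk u e 1
    walk-from-u refl = step (adj-sym {x = v} {u} v~u) here

    via-a : parity a ≡ parity v → DistLE u p radius
    via-a a≡v with claw-near-edge⇒centre c a≡v a~b (mapLeaves c (λ {w} → near-ends {w}) balls)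
    ... | a=v , t≤½ = inj₁ (1 , walk-from-u a=v , s≤½⇒1+s≤radius t≤½)

    via-b : parity b ≡ parity v → DistLE u p radius
    via-b b≡v with claw-near-edge⇒centre c b≡v (adj-sym {x = a} {b} a~b)
                     (mapLeaves c (λ {w} → swap ∘ near-ends {w}) balls)
    ... | b=v , 1-t≤½ = inj₂ (1 , walk-from-u b=v , s≤½⇒1+s≤radius 1-t≤½)

maximal-absorbs-common-point : ∀ {n r σ} → IsMaximalCechSimplex n r σ → (p : Point n) →
  (∀ w → σ w → DistLE w p (r * ½)) → ∀ u → DistLE u p (r * ½) → σ u
maximal-absorbs-common-point {n} {r} {σ} (_ , maximal) p σ-near u u-near =
  maximal σ∪u ((u , inj₂ refl) , p , σ∪u-near) (λ _ → inj₁) u (inj₂ refl)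
  where
  σ∪u : VSet n
  σ∪u w = σ w ⊎ w ≡ u

  σ∪u-near : ∀ w → σ∪u w → DistLE w p (r * ½)
  σ∪u-near w (inj₁ w∈σ) = σ-near w w∈σ
  σ∪u-near w (inj₂ refl) = u-near

lemma5p8 : (n : ℕ) (σ : VSet n) → IsMaximalCechSimplex n (+ 3 / 1) σ →
    (v : Vertex n) →
    Σ (Vertex n) (λ u₁ → Σ (Vertex n) (λ u₂ → Σ (Vertex n) (λ u₃ →
      (u₁ ≢ u₂) × (u₁ ≢ u₃) × (u₂ ≢ u₃) ×
      (Adj v u₁ × σ u₁) × (Adj v u₂ × σ u₂) × (Adj v u₃ × σ u₃)))) →
    ∀ u → Adj v u → σ u
lemma5p8 n σ σ-max@((_ , p , σ-near) , _) v
         (u₁ , u₂ , u₃ , u₁≢u₂ , u₁≢u₃ , u₂≢u₃ , (v~u₁ , u₁∈σ) , (v~u₂ , u₂∈σ) , (v~u₃ , u₃∈σ)) u v~u =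
  maximal-absorbs-common-point {r = + 3 / 1} σ-max p σ-near u
    (claw-ball⇒neighbour-ball claw p (σ-near u₁ u₁∈σ , σ-near u₂ u₂∈σ , σ-near u₃ u₃∈σ) v~u)
  where
  claw : Claw v
  claw = record { leaf₁ = u₁ ; leaf₂ = u₂ ; leaf₃ = u₃ ; adj₁ = v~u₁ ; adj₂ = v~u₂ ; adj₃ = v~u₃
                ; leaf₁≢leaf₂ = u₁≢u₂ ; leaf₁≢leaf₃ = u₁≢u₃ ; leaf₂≢leaf₃ = u₂≢u₃ }
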